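{- As $n\to\infty$, $ex_3(n,\mathbb{B}_2^3K_3)=(1+o(1))\frac{n^2}{2}$.
   Context: A $3$-uniform hypergraph consists of a finite vertex set and a set of distinct $3$-element subsets (hyperedges). A $3$-uniform hypergraph $\mathcal{F}$ is a $2$-wise Berge copy of a graph $F$ if $|E(\mathcal{F})|=2|E(F)|$ and there exist an injection $i:V(F)\to V(\mathcal{F})$ and a map $h$ assigning to each edge $e$ of $F$ a set $h(e)$ of $2$ hyperedges of $\mathcal{F}$ such that $h(e)\cap h(e')=\emptyset$ for distinct edges $e,e'$, and for every edge $e=xy$ of $F$, $\{i(x),i(y)\}\subseteq A$ for both $A\in h(e)$. $\mathbb{B}_2^3F$ is the family of such copies. $ex_3(n,\mathbb{F})$ is the maximum number of hyperedges in a $3$-uniform hypergraph on $n$ vertices containing no member of $\mathbb{F}$ as a subhypergraph. -}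

module Defs where

open import Data.Nat using (ℕ; _+_; _*_; _≤_; _^_)
open import Data.Fin using (Fin; _<_)
open import Data.Fin.Patterns using (0F; 1F; 2F; 3F; 4F; 5F)
open import Data.List using (List; length)
open import Data.List.Relation.Unary.All using (All)
open import Data.List.Relation.Unary.Unique.Propositional using (Unique)
open import Data.List.Membership.Propositional using (_∈_)
open import Data.Product using (Σ; _×_; _,_; ∃; ∃-syntax)
open import Data.Sum using (_⊎_)
open import Relation.Binary.PropositionalEquality using (_≡_; _≢_)
open import Relation.Nullary using (¬_)
open import Function.Definitions using (Injective)

-- A 3-element subset {a,b,c} of Fin n, written canonically with a < b < c.
Triple : ℕ → Set
Triple n = Fin n × Fin n × Fin n

IsSorted3 : ∀ {n} → Triple n → Set
IsSorted3 (a , b , c) = a < b × b < c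

_∈₃_ : ∀ {n} → Fin n → Triple n → Set
x ∈₃ (a , b , c) = x ≡ a ⊎ x ≡ b ⊎ x ≡ c

record Hypergraph3 (n : ℕ) : Set where
  field
    edges    : List (Triple n)
    sorted   : All IsSorted3 edges
    distinct : Unique edges

open Hypergraph3 public

numEdges : ∀ {n} → Hypergraph3 n → ℕ
numEdges H = length (edges H)

-- H contains a member of 𝔹₂³K₃ as a subhypergraph: there are three distinct
-- vertices x,y,z (image of the injection i) and six distinct hyperedges of H
-- (the disjoint 2-sets h(xy), h(yz), h(xz)) with h(e) covering the ends of e.
ContainsB23K3 : ∀ {n} → Hypergraph3 n → Set
ContainsB23K3 {n} H =
  Σ (Fin n) λ x → Σ (Fin n) λ y → Σ (Fin n) λ z →
  x ≢ y × y ≢ z × x ≢ z ×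
  Σ (Fin 6 → Triple n) λ f →
    Injective _≡_ _≡_ f ×
    (∀ i → f i ∈ edges H) ×
    (x ∈₃ f 0F × y ∈₃ f 0F) × (x ∈₃ f 1F × y ∈₃ f 1F) ×
    (y ∈₃ f 2F × z ∈₃ f 2F) × (y ∈₃ f 3F × z ∈₃ f 3F) ×
    (x ∈₃ f 4F × z ∈₃ f 4F) × (x ∈₃ f 5F × z ∈₃ f 5F)

IsEx : ℕ → ℕ → Set
IsEx n m =
  (Σ (Hypergraph3 n) λ H → ¬ ContainsB23K3 H × numEdges H ≡ m) ×
  (∀ (H : Hypergraph3 n) → ¬ ContainsB23K3 H → numEdges H ≤ m)

module Submission where

-- Upper bound: in a 𝔹₂³K₃-free hypergraph every hyperedge e can be given two
-- ordered pairs of its vertices that it owns, no ordered pair being owned twice,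
-- so 2|E| ≤ n². A pair of e lying in no other hyperedge gives e both of its
-- orientations; a pair lying in exactly one other hyperedge t gives e one
-- orientation, the increasing one iff e precedes t in a fixed order on triples.
-- If e got fewer than two pairs this way, two of its sides would each lie in at
-- least two further hyperedges and the third side in at least one, and together
-- with e these give a 𝔹₂³K₃.
--
-- Lower bound: the star of all triples through one vertex is 𝔹₂³K₃-free, since
-- two of the three branch vertices avoid the centre and lie in a single star
-- edge; it has (n-1)(n-2)/2 edges, so n² ≤ 2 ex + 3n.

open import Defs
open import Data.Nat using (ℕ; suc; _+_; _*_; _≤_; _^_)
open import Data.Product using (Σ; _×_)

import Data.Nat as ℕ
import Data.Nat.Properties as ℕ
open import Data.Nat.Tactic.RingSolver using (solve-∀)
open import Data.Fin using (Fin; zero; suc; _<_; combine; remQuot)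
import Data.Fin.Properties as Fin
open import Data.Fin.Patterns using (0F; 1F; 2F; 3F; 4F; 5F)
open import Data.List using (List; []; _∷_; _++_; map; filter; allFin; length; lookup)
open import Data.List.Properties using (length-++; length-map; length-tabulate)
open import Data.List.Relation.Unary.All as All using (All)
import Data.List.Relation.Unary.All.Properties as All
open import Data.List.Relation.Unary.Any using (here; there)
open import Data.List.Relation.Unary.Unique.Propositional using (Unique; _∷_)
import Data.List.Relation.Unary.Unique.Propositional.Properties as Unique
open import Data.List.Membership.Propositional using (_∈_)
open import Data.List.Membership.Propositional.Properties
  using (∈-lookup; ∈-map⁻; ∈-filter⁻; ∈-filter⁺)
open import Data.Product using (_,_; proj₁; proj₂; uncurry; swap; ∃-syntax)
import Data.Product as Product
open import Data.Product.Properties using (≡-dec)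
open import Data.Sum using (_⊎_; inj₁; inj₂; [_,_]′)
open import Data.Empty using (⊥; ⊥-elim)
open import Function using (_∘_)
open import Function.Definitions using (Injective)
open import Relation.Binary.Definitions using (tri<; tri≈; tri>)
open import Relation.Binary.PropositionalEquality
open import Relation.Nullary using (¬_; Dec; yes; no; ¬?; _×-dec_; _⊎-dec_)

lookup-injective : ∀ {A : Set} {xs : List A} → Unique xs →
                   ∀ {i j} → lookup xs i ≡ lookup xs j → i ≡ j
lookup-injective (_  ∷ _) {zero}  {zero}  _  = refl
lookup-injective (x∉ ∷ _) {zero}  {suc j} eq = ⊥-elim (All.lookup x∉ (∈-lookup j) eq)
lookup-injective (x∉ ∷ _) {suc i} {zero}  eq = ⊥-elim (All.lookup x∉ (∈-lookup i) (sym eq))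
lookup-injective (_  ∷ u) {suc i} {suc j} eq = cong suc (lookup-injective u eq)

remQuot-injective : ∀ {m} n {i j : Fin (m * n)} → remQuot {m} n i ≡ remQuot n j → i ≡ j
remQuot-injective {m} n {i} {j} eq = begin
  i                                 ≡⟨ Fin.combine-remQuot {m} n i ⟨
  uncurry combine (remQuot {m} n i) ≡⟨ cong (uncurry combine) eq ⟩
  uncurry combine (remQuot {m} n j) ≡⟨ Fin.combine-remQuot {m} n j ⟩
  j                                 ∎
  where open ≡-Reasoning

product-injective⇒≤ : ∀ {a b c d} {f : Fin a × Fin b → Fin c × Fin d} →
                      Injective _≡_ _≡_ f → a * b ≤ c * d
product-injective⇒≤ {a} {b} {c} {d} f-inj =
  Fin.injective⇒≤ (remQuot-injective {a} b ∘ f-inj ∘ combine-injective)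
  where
  combine-injective : ∀ {x y : Fin c × Fin d} → uncurry combine x ≡ uncurry combine y → x ≡ y
  combine-injective eq = uncurry (cong₂ _,_) (Fin.combine-injective _ _ _ _ eq)

module _ {n : ℕ} where

  Orients : Fin n × Fin n → Fin n × Fin n → Set
  Orients τ (p , q) = τ ≡ (p , q) ⊎ τ ≡ (q , p)

  orients : ∀ {u v p q} → u ≢ v → u ≡ p ⊎ u ≡ q → v ≡ p ⊎ v ≡ q → Orients (u , v) (p , q)
  orients u≢v (inj₁ refl) (inj₁ refl) = ⊥-elim (u≢v refl)
  orients _   (inj₁ refl) (inj₂ refl) = inj₁ refl
  orients _   (inj₂ refl) (inj₁ refl) = inj₂ refl
  orients u≢v (inj₂ refl) (inj₂ refl) = ⊥-elim (u≢v refl)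

  orients-unique : ∀ {τ p q p′ q′} → p < q → p′ < q′ →
                   Orients τ (p , q) → Orients τ (p′ , q′) → (p , q) ≡ (p′ , q′)
  orients-unique _   _     (inj₁ refl) (inj₁ refl) = refl
  orients-unique p<q p′<q′ (inj₁ refl) (inj₂ refl) = ⊥-elim (Fin.<-asym p<q p′<q′)
  orients-unique p<q p′<q′ (inj₂ refl) (inj₁ refl) = ⊥-elim (Fin.<-asym p<q p′<q′)
  orients-unique _   _     (inj₂ refl) (inj₂ refl) = refl

  ∈₃-≮-min : ∀ {p q r x : Fin n} → p < q → q < r → x ∈₃ (p , q , r) → ¬ x < p
  ∈₃-≮-min _   _   (inj₁ refl)        x<p = Fin.<-irrefl refl x<p
  ∈₃-≮-min p<q _   (inj₂ (inj₁ refl)) x<p = Fin.<-asym p<q x<p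
  ∈₃-≮-min p<q q<r (inj₂ (inj₂ refl)) x<p = Fin.<-asym (Fin.<-trans p<q q<r) x<p

  ∈₃-≯-max : ∀ {p q r x : Fin n} → p < q → q < r → x ∈₃ (p , q , r) → ¬ r < x
  ∈₃-≯-max p<q q<r (inj₁ refl)        r<x = Fin.<-asym (Fin.<-trans p<q q<r) r<x
  ∈₃-≯-max _   q<r (inj₂ (inj₁ refl)) r<x = Fin.<-asym q<r r<x
  ∈₃-≯-max _   _   (inj₂ (inj₂ refl)) r<x = Fin.<-irrefl refl r<x

  ∈₃-below-middle : ∀ {p q r x : Fin n} → q < r → x ∈₃ (p , q , r) → x < q → x ≡ p
  ∈₃-below-middle _   (inj₁ x≡p)         _   = x≡p
  ∈₃-below-middle _   (inj₂ (inj₁ refl)) x<q = ⊥-elim (Fin.<-irrefl refl x<q)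
  ∈₃-below-middle q<r (inj₂ (inj₂ refl)) x<q = ⊥-elim (Fin.<-asym q<r x<q)

  ∈₃-above-middle : ∀ {p q r x : Fin n} → p < q → x ∈₃ (p , q , r) → q < x → x ≡ r
  ∈₃-above-middle p<q (inj₁ refl)        q<x = ⊥-elim (Fin.<-asym p<q q<x)
  ∈₃-above-middle _   (inj₂ (inj₁ refl)) q<x = ⊥-elim (Fin.<-irrefl refl q<x)
  ∈₃-above-middle _   (inj₂ (inj₂ x≡r))  _   = x≡r

  sorted-triple-unique : ∀ {p q r a b c : Fin n} → p < q → q < r → a < b → b < c →
                         a ∈₃ (p , q , r) → b ∈₃ (p , q , r) → c ∈₃ (p , q , r) →
                         (p , q , r) ≡ (a , b , c)
  sorted-triple-unique p<q q<r a<b _ a∈ (inj₁ refl) _ = ⊥-elim (∈₃-≮-min p<q q<r a∈ a<b)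
  sorted-triple-unique {q = q} p<q q<r a<b b<c a∈ (inj₂ (inj₁ refl)) c∈ =
    sym (cong₂ (λ x z → x , q , z) (∈₃-below-middle q<r a∈ a<b) (∈₃-above-middle p<q c∈ b<c))
  sorted-triple-unique p<q q<r _ b<c _ (inj₂ (inj₂ refl)) c∈ = ⊥-elim (∈₃-≯-max p<q q<r c∈ b<c)

  _∈₃?_ : (x : Fin n) (t : Triple n) → Dec (x ∈₃ t)
  x ∈₃? (a , b , c) = x Fin.≟ a ⊎-dec x Fin.≟ b ⊎-dec x Fin.≟ c

  _≟₃_ : (s t : Triple n) → Dec (s ≡ t)
  _≟₃_ = ≡-dec Fin._≟_ (≡-dec Fin._≟_ Fin._≟_)

  -- Any strict total order on triples would do: it only decides which of two
  -- hyperedges sharing a pair gets the increasing orientation of that pair.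
  key : Triple n → Fin (n * (n * n))
  key (a , b , c) = combine a (combine b c)

  key-injective : ∀ {s t} → key s ≡ key t → s ≡ t
  key-injective {a , b , c} {a′ , b′ , c′} eq
    with refl , eq′ ← Fin.combine-injective a _ a′ _ eq
    with refl , refl ← Fin.combine-injective b c b′ c′ eq′ = refl

  _≺_ : Triple n → Triple n → Set
  s ≺ t = key s < key t

  ≺-connex : ∀ {s t} → s ≢ t → s ≺ t ⊎ t ≺ s
  ≺-connex {s} {t} s≢t with Fin.<-cmp (key s) (key t)
  ... | tri< s≺t _ _ = inj₁ s≺t
  ... | tri≈ _ eq _  = ⊥-elim (s≢t (key-injective eq))
  ... | tri> _ _ t≺s = inj₂ t≺s

module _ {n : ℕ} (H : Hypergraph3 n) where

  Rival : Triple n → Fin n × Fin n → Triple n → Set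
  Rival e (u , v) t = t ≢ e × u ∈₃ t × v ∈₃ t

  rival? : ∀ e uv t → Dec (Rival e uv t)
  rival? e (u , v) t = ¬? (t ≟₃ e) ×-dec u ∈₃? t ×-dec v ∈₃? t

  rivals : Triple n → Fin n × Fin n → List (Triple n)
  rivals e uv = filter (rival? e uv) (edges H)

  ∈-rivals⁻ : ∀ {e uv t} → t ∈ rivals e uv → t ∈ edges H × Rival e uv t
  ∈-rivals⁻ {e} {uv} = ∈-filter⁻ (rival? e uv)

  ∈-rivals⁺ : ∀ {e uv t} → t ∈ edges H → Rival e uv t → t ∈ rivals e uv
  ∈-rivals⁺ {e} {uv} = ∈-filter⁺ (rival? e uv)

  rivals-unique : ∀ e uv → Unique (rivals e uv)
  rivals-unique e uv = Unique.filter⁺ (rival? e uv) (distinct H)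

  no-rival : ∀ {e uv t} → rivals e uv ≡ [] → t ∈ edges H → ¬ Rival e uv t
  no-rival r t∈H rival with () ← subst (_ ∈_) r (∈-rivals⁺ t∈H rival)

  sole-rival : ∀ {e uv t t′} → rivals e uv ≡ t ∷ [] → t′ ∈ edges H → Rival e uv t′ → t′ ≡ t
  sole-rival r t′∈H rival with subst (_ ∈_) r (∈-rivals⁺ t′∈H rival)
  ... | here t′≡t = t′≡t

  Owns : Triple n → Fin n × Fin n → Set
  Owns e (u , v) = u ∈₃ e × v ∈₃ e ×
    (∀ {t} → t ∈ edges H → Rival e (u , v) t → (e ≺ t → u < v) × (t ≺ e → v < u))

  owner-unique : ∀ {e t τ} → e ∈ edges H → t ∈ edges H → Owns e τ → Owns t τ → e ≡ t
  owner-unique {e} {t} e∈H t∈H (u∈e , v∈e , own-e) (u∈t , v∈t , own-t) with e ≟₃ t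
  ... | yes e≡t = e≡t
  ... | no e≢t with ≺-connex e≢t
  ...   | inj₁ e≺t = ⊥-elim (Fin.<-asym (proj₁ (own-e t∈H (e≢t ∘ sym , u∈t , v∈t)) e≺t)
                                        (proj₂ (own-t e∈H (e≢t , u∈e , v∈e)) e≺t))
  ...   | inj₂ t≺e = ⊥-elim (Fin.<-asym (proj₁ (own-t e∈H (e≢t , u∈e , v∈e)) t≺e)
                                        (proj₂ (own-e t∈H (e≢t ∘ sym , u∈t , v∈t)) t≺e))

  no-rival⇒owned : ∀ {e p q} → p ∈₃ e → q ∈₃ e → rivals e (p , q) ≡ [] →
                   Owns e (p , q) × Owns e (q , p)
  no-rival⇒owned p∈e q∈e r =
    (p∈e , q∈e , λ t∈H rival → ⊥-elim (no-rival r t∈H rival)) ,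
    (q∈e , p∈e , λ { t∈H (t≢e , q∈t , p∈t) → ⊥-elim (no-rival r t∈H (t≢e , p∈t , q∈t)) })

  sole-rival⇒owned : ∀ {e p q t} → p < q → p ∈₃ e → q ∈₃ e → rivals e (p , q) ≡ t ∷ [] →
                     ∃[ τ ] Orients τ (p , q) × Owns e τ
  sole-rival⇒owned {e} {p} {q} {t} p<q p∈e q∈e r
    with t≢e ← proj₁ (proj₂ (∈-rivals⁻ (subst (t ∈_) (sym r) (here refl))))
    with ≺-connex (t≢e ∘ sym)
  ... | inj₁ e≺t = (p , q) , inj₁ refl , p∈e , q∈e , increasing
    where
    increasing : ∀ {t′} → t′ ∈ edges H → Rival e (p , q) t′ → (e ≺ t′ → p < q) × (t′ ≺ e → q < p)
    increasing t′∈H rival with refl ← sole-rival r t′∈H rival =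
      (λ _ → p<q) , λ t≺e → ⊥-elim (Fin.<-asym e≺t t≺e)
  ... | inj₂ t≺e = (q , p) , inj₂ refl , q∈e , p∈e , decreasing
    where
    decreasing : ∀ {t′} → t′ ∈ edges H → Rival e (q , p) t′ → (e ≺ t′ → q < p) × (t′ ≺ e → p < q)
    decreasing t′∈H (t′≢e , q∈t′ , p∈t′) with refl ← sole-rival r t′∈H (t′≢e , p∈t′ , q∈t′) =
      (λ e≺t → ⊥-elim (Fin.<-asym e≺t t≺e)) , λ _ → p<q

  OwnsTwo : Triple n → Set
  OwnsTwo e = Σ (Fin 2 → Fin n × Fin n) λ τ → τ 0F ≢ τ 1F × (∀ i → Owns e (τ i))

  ownsTwo⇒edges≤ : (∀ {e} → e ∈ edges H → OwnsTwo e) → numEdges H * 2 ≤ n * n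
  ownsTwo⇒edges≤ own = product-injective⇒≤ token-injective
    where
    token : Fin (numEdges H) × Fin 2 → Fin n × Fin n
    token (i , s) = proj₁ (own (∈-lookup i)) s

    orientation-injective : ∀ {e} (e∈H : e ∈ edges H) {s s′} →
                            proj₁ (own e∈H) s ≡ proj₁ (own e∈H) s′ → s ≡ s′
    orientation-injective e∈H {0F} {0F} _  = refl
    orientation-injective e∈H {0F} {1F} eq = ⊥-elim (proj₁ (proj₂ (own e∈H)) eq)
    orientation-injective e∈H {1F} {0F} eq = ⊥-elim (proj₁ (proj₂ (own e∈H)) (sym eq))
    orientation-injective e∈H {1F} {1F} _  = refl

    token-injective : Injective _≡_ _≡_ token
    token-injective {i , s} {j , s′} eq
      with refl ← lookup-injective (distinct H)
                    (owner-unique (∈-lookup i) (∈-lookup j)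
                      (proj₂ (proj₂ (own (∈-lookup i))) s)
                      (subst (Owns _) (sym eq) (proj₂ (proj₂ (own (∈-lookup j))) s′)))
      = cong (i ,_) (orientation-injective (∈-lookup i) eq)

module _ {n : ℕ} (corner : Fin 3 → Fin n) where

  -- Sides of the triangle are indexed by the opposite corner.
  Through : Fin 3 → Triple n → Set
  Through k t = ∀ j → j ≢ k → corner j ∈₃ t

  Spanning : Triple n → Set
  Spanning t = ∀ j → corner j ∈₃ t

  through-two⇒spanning : ∀ {k k′ t} → k ≢ k′ → Through k t → Through k′ t → Spanning t
  through-two⇒spanning {k} k≢k′ t-k t-k′ j with j Fin.≟ k
  ... | yes refl = t-k′ j k≢k′
  ... | no j≢k   = t-k j j≢k

module _ {n : ℕ} (H : Hypergraph3 n) (corner : Fin 3 → Fin n) where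

  record Side (k₀ k : Fin 3) : Set where
    field
      edge          : Fin 2 → Triple n
      edge-distinct : edge 0F ≢ edge 1F
      edge∈H        : ∀ i → edge i ∈ edges H
      edge-through  : ∀ i → Through corner k (edge i)
      spanning⇒k₀   : ∀ i → Spanning corner (edge i) → k ≡ k₀

    edge-injective : ∀ {i i′} → edge i ≡ edge i′ → i ≡ i′
    edge-injective {0F} {0F} _  = refl
    edge-injective {0F} {1F} eq = ⊥-elim (edge-distinct eq)
    edge-injective {1F} {0F} eq = ⊥-elim (edge-distinct (sym eq))
    edge-injective {1F} {1F} _  = refl

  open Side

  -- Slots 2k and 2k+1 of the copy hold the two edges of side k, which is why
  -- x, y, z are the corners 1, 2, 0. The six edges are distinct because an
  -- edge on two sides spans all corners, which only side k₀ allows.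
  berge-triangle : Injective _≡_ _≡_ corner → ∀ k₀ → (∀ k → Side k₀ k) → ContainsB23K3 H
  berge-triangle corner-injective k₀ side =
    corner 1F , corner 2F , corner 0F ,
    corners-distinct (λ ()) , corners-distinct (λ ()) , corners-distinct (λ ()) ,
    f , f-injective , (λ i → edge∈H (side _) _) ,
    (on 0F 0F 1F (λ ()) , on 0F 0F 2F (λ ())) , (on 0F 1F 1F (λ ()) , on 0F 1F 2F (λ ())) ,
    (on 1F 0F 2F (λ ()) , on 1F 0F 0F (λ ())) , (on 1F 1F 2F (λ ()) , on 1F 1F 0F (λ ())) ,
    (on 2F 0F 1F (λ ()) , on 2F 0F 0F (λ ())) , (on 2F 1F 1F (λ ()) , on 2F 1F 0F (λ ()))
    where
    corners-distinct : ∀ {j k} → j ≢ k → corner j ≢ corner k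
    corners-distinct j≢k = j≢k ∘ corner-injective

    g : Fin 3 × Fin 2 → Triple n
    g (k , i) = edge (side k) i

    on : ∀ k i j → j ≢ k → corner j ∈₃ g (k , i)
    on k i = edge-through (side k) i

    g-injective : Injective _≡_ _≡_ g
    g-injective {k , i} {k′ , i′} eq with k Fin.≟ k′
    ... | yes refl = cong (k ,_) (edge-injective (side k) eq)
    ... | no k≢k′  = ⊥-elim (k≢k′ (trans (spanning⇒k₀ (side k) i spans)
                                         (sym (spanning⇒k₀ (side k′) i′ (subst (Spanning corner) eq spans)))))
      where
      spans : Spanning corner (g (k , i))
      spans = through-two⇒spanning corner k≢k′ (edge-through (side k) i)
                (subst (Through corner k′) (sym eq) (edge-through (side k′) i′))

    f : Fin 6 → Triple n
    f = g ∘ remQuot {3} 2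

    f-injective : Injective _≡_ _≡_ f
    f-injective = remQuot-injective {3} 2 ∘ g-injective

module SortedEdge {n : ℕ} (H : Hypergraph3 n) (free : ¬ ContainsB23K3 H)
                  {a b c : Fin n} (a<b : a < b) (b<c : b < c) (e∈H : (a , b , c) ∈ edges H) where

  e : Triple n
  e = a , b , c

  a<c : a < c
  a<c = Fin.<-trans a<b b<c

  corner : Fin 3 → Fin n
  corner 0F = a
  corner 1F = b
  corner 2F = c

  side : Fin 3 → Fin n × Fin n
  side 0F = b , c
  side 1F = a , c
  side 2F = a , b

  corner∈e : ∀ j → corner j ∈₃ e
  corner∈e 0F = inj₁ refl
  corner∈e 1F = inj₂ (inj₁ refl)
  corner∈e 2F = inj₂ (inj₂ refl)

  side-increasing : ∀ k → proj₁ (side k) < proj₂ (side k)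
  side-increasing 0F = b<c
  side-increasing 1F = a<c
  side-increasing 2F = a<b

  side⊆e : ∀ k → proj₁ (side k) ∈₃ e × proj₂ (side k) ∈₃ e
  side⊆e 0F = corner∈e 1F , corner∈e 2F
  side⊆e 1F = corner∈e 0F , corner∈e 2F
  side⊆e 2F = corner∈e 0F , corner∈e 1F

  corner∈side : ∀ {j k} → j ≢ k → corner j ≡ proj₁ (side k) ⊎ corner j ≡ proj₂ (side k)
  corner∈side {0F} {0F} j≢k = ⊥-elim (j≢k refl)
  corner∈side {1F} {0F} _   = inj₁ refl
  corner∈side {2F} {0F} _   = inj₂ refl
  corner∈side {0F} {1F} _   = inj₁ refl
  corner∈side {1F} {1F} j≢k = ⊥-elim (j≢k refl)
  corner∈side {2F} {1F} _   = inj₂ refl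
  corner∈side {0F} {2F} _   = inj₁ refl
  corner∈side {1F} {2F} _   = inj₂ refl
  corner∈side {2F} {2F} j≢k = ⊥-elim (j≢k refl)

  corner-injective : Injective _≡_ _≡_ corner
  corner-injective {0F} {0F} _  = refl
  corner-injective {0F} {1F} eq = ⊥-elim (Fin.<⇒≢ a<b eq)
  corner-injective {0F} {2F} eq = ⊥-elim (Fin.<⇒≢ a<c eq)
  corner-injective {1F} {0F} eq = ⊥-elim (Fin.<⇒≢ a<b (sym eq))
  corner-injective {1F} {1F} _  = refl
  corner-injective {1F} {2F} eq = ⊥-elim (Fin.<⇒≢ b<c eq)
  corner-injective {2F} {0F} eq = ⊥-elim (Fin.<⇒≢ a<c (sym eq))
  corner-injective {2F} {1F} eq = ⊥-elim (Fin.<⇒≢ b<c (sym eq))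
  corner-injective {2F} {2F} _  = refl

  side-injective : ∀ {k k′} → side k ≡ side k′ → k ≡ k′
  side-injective {0F} {0F} _  = refl
  side-injective {0F} {1F} eq = ⊥-elim (Fin.<⇒≢ a<b (sym (cong proj₁ eq)))
  side-injective {0F} {2F} eq = ⊥-elim (Fin.<⇒≢ a<b (sym (cong proj₁ eq)))
  side-injective {1F} {0F} eq = ⊥-elim (Fin.<⇒≢ a<b (cong proj₁ eq))
  side-injective {1F} {1F} _  = refl
  side-injective {1F} {2F} eq = ⊥-elim (Fin.<⇒≢ b<c (sym (cong proj₂ eq)))
  side-injective {2F} {0F} eq = ⊥-elim (Fin.<⇒≢ a<b (cong proj₁ eq))
  side-injective {2F} {1F} eq = ⊥-elim (Fin.<⇒≢ b<c (cong proj₂ eq))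
  side-injective {2F} {2F} _  = refl

  spanning⇒e : ∀ {t} → t ∈ edges H → Spanning corner t → t ≡ e
  spanning⇒e {p , q , r} t∈H span with p<q , q<r ← All.lookup (sorted H) t∈H =
    sorted-triple-unique p<q q<r a<b b<c (span 0F) (span 1F) (span 2F)

  module _ (k : Fin 3) {t} (t∈rivals : t ∈ rivals H e (side k)) where

    rival∈H : t ∈ edges H
    rival∈H = proj₁ (∈-rivals⁻ H t∈rivals)

    rival : Rival H e (side k) t
    rival = proj₂ (∈-rivals⁻ H t∈rivals)

    rival-through : Through corner k t
    rival-through j j≢k = [ (λ eq → subst (_∈₃ t) (sym eq) (proj₁ (proj₂ rival))) ,
                            (λ eq → subst (_∈₃ t) (sym eq) (proj₂ (proj₂ rival))) ]′ (corner∈side j≢k)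

    rival-not-spanning : ¬ Spanning corner t
    rival-not-spanning span = proj₁ rival (spanning⇒e rival∈H span)

  self-side : ∀ k₀ {t ts} → rivals H e (side k₀) ≡ t ∷ ts → Side H corner k₀ k₀
  self-side k₀ {t} r = record
    { edge          = λ { 0F → t ; 1F → e }
    ; edge-distinct = proj₁ (rival k₀ t∈rivals)
    ; edge∈H        = λ { 0F → rival∈H k₀ t∈rivals ; 1F → e∈H }
    ; edge-through  = λ { 0F → rival-through k₀ t∈rivals ; 1F j _ → corner∈e j }
    ; spanning⇒k₀   = λ _ _ → refl
    }
    where
    t∈rivals : t ∈ rivals H e (side k₀)
    t∈rivals = subst (t ∈_) (sym r) (here refl)

  rival-side : ∀ {k₀} k {t t′ ts} → rivals H e (side k) ≡ t ∷ t′ ∷ ts → Side H corner k₀ k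
  rival-side k {t} {t′} r = record
    { edge          = λ { 0F → t ; 1F → t′ }
    ; edge-distinct = t≢t′
    ; edge∈H        = λ { 0F → rival∈H k t∈rivals ; 1F → rival∈H k t′∈rivals }
    ; edge-through  = λ { 0F → rival-through k t∈rivals ; 1F → rival-through k t′∈rivals }
    ; spanning⇒k₀   = λ { 0F span → ⊥-elim (rival-not-spanning k t∈rivals span)
                        ; 1F span → ⊥-elim (rival-not-spanning k t′∈rivals span) }
    }
    where
    t∈rivals : t ∈ rivals H e (side k)
    t∈rivals = subst (t ∈_) (sym r) (here refl)
    t′∈rivals : t′ ∈ rivals H e (side k)
    t′∈rivals = subst (t′ ∈_) (sym r) (there (here refl))
    t≢t′ : t ≢ t′
    t≢t′ with t∉ ∷ _ ← subst Unique r (rivals-unique H e (side k)) = All.head t∉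

  crowded-triangle : ∀ k₀ {t ts} → rivals H e (side k₀) ≡ t ∷ ts →
                     (∀ k → k ≢ k₀ → Side H corner k₀ k) → ⊥
  crowded-triangle k₀ r₀ crowded = free (berge-triangle H corner corner-injective k₀ side-of)
    where
    side-of : ∀ k → Side H corner k₀ k
    side-of k with k Fin.≟ k₀
    ... | yes refl = self-side k₀ r₀
    ... | no k≢k₀  = crowded k k≢k₀

  no-rival-side : ∀ k → rivals H e (side k) ≡ [] → OwnsTwo H e
  no-rival-side k r =
    (λ { 0F → side k ; 1F → swap (side k) }) ,
    (λ eq → Fin.<-irrefl (cong proj₁ eq) (side-increasing k)) ,
    λ { 0F → proj₁ owned ; 1F → proj₂ owned }
    where
    owned : Owns H e (side k) × Owns H e (swap (side k))
    owned = no-rival⇒owned H (proj₁ (side⊆e k)) (proj₂ (side⊆e k)) r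

  sole-rival-token : ∀ k {t} → rivals H e (side k) ≡ t ∷ [] → ∃[ τ ] Orients τ (side k) × Owns H e τ
  sole-rival-token k = sole-rival⇒owned H (side-increasing k) (proj₁ (side⊆e k)) (proj₂ (side⊆e k))

  sole-rival-sides : ∀ {k k′ t t′} → k ≢ k′ → rivals H e (side k) ≡ t ∷ [] →
                     rivals H e (side k′) ≡ t′ ∷ [] → OwnsTwo H e
  sole-rival-sides {k} {k′} k≢k′ r r′
    with τ  , τ-orients  , τ-owned  ← sole-rival-token k r
    with τ′ , τ′-orients , τ′-owned ← sole-rival-token k′ r′
    = (λ { 0F → τ ; 1F → τ′ }) ,
      (λ τ≡τ′ → k≢k′ (side-injective (orients-unique (side-increasing k) (side-increasing k′)
                       τ-orients (subst (λ σ → Orients σ (side k′)) (sym τ≡τ′) τ′-orients)))) ,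
      λ { 0F → τ-owned ; 1F → τ′-owned }

  owns-two : OwnsTwo H e
  owns-two with rivals H e (side 0F) in r₀ | rivals H e (side 1F) in r₁ | rivals H e (side 2F) in r₂
  ... | []          | _           | _           = no-rival-side 0F r₀
  ... | _ ∷ _       | []          | _           = no-rival-side 1F r₁
  ... | _ ∷ _       | _ ∷ _       | []          = no-rival-side 2F r₂
  ... | _ ∷ []      | _ ∷ []      | _ ∷ _       = sole-rival-sides {0F} {1F} (λ ()) r₀ r₁
  ... | _ ∷ []      | _ ∷ _ ∷ _   | _ ∷ []      = sole-rival-sides {0F} {2F} (λ ()) r₀ r₂
  ... | _ ∷ _ ∷ _   | _ ∷ []      | _ ∷ []      = sole-rival-sides {1F} {2F} (λ ()) r₁ r₂
  ... | _ ∷ []      | _ ∷ _ ∷ _   | _ ∷ _ ∷ _   = ⊥-elim (crowded-triangle 0F r₀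
    λ { 0F 0≢0 → ⊥-elim (0≢0 refl) ; 1F _ → rival-side 1F r₁ ; 2F _ → rival-side 2F r₂ })
  ... | _ ∷ _ ∷ _   | _ ∷ []      | _ ∷ _ ∷ _   = ⊥-elim (crowded-triangle 1F r₁
    λ { 0F _ → rival-side 0F r₀ ; 1F 1≢1 → ⊥-elim (1≢1 refl) ; 2F _ → rival-side 2F r₂ })
  ... | _ ∷ _ ∷ _   | _ ∷ _ ∷ _   | _ ∷ _       = ⊥-elim (crowded-triangle 2F r₂
    λ { 0F _ → rival-side 0F r₀ ; 1F _ → rival-side 1F r₁ ; 2F 2≢2 → ⊥-elim (2≢2 refl) })

free⇒edges≤ : ∀ {n} (H : Hypergraph3 n) → ¬ ContainsB23K3 H → numEdges H * 2 ≤ n * n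
free⇒edges≤ H free = ownsTwo⇒edges≤ H owns-two-of
  where
  owns-two-of : ∀ {e} → e ∈ edges H → OwnsTwo H e
  owns-two-of {a , b , c} e∈H with a<b , b<c ← All.lookup (sorted H) e∈H =
    SortedEdge.owns-two H free a<b b<c e∈H

increasing-pairs : (n : ℕ) → List (Fin n × Fin n)
increasing-pairs ℕ.zero    = []
increasing-pairs (suc n) =
  map (λ j → zero , suc j) (allFin n) ++ map (Product.map suc suc) (increasing-pairs n)

increasing-pairs-increasing : ∀ n → All (uncurry _<_) (increasing-pairs n)
increasing-pairs-increasing ℕ.zero  = All.[]
increasing-pairs-increasing (suc n) =
  All.++⁺ (All.map⁺ (All.tabulate (λ _ → ℕ.z<s)))
          (All.map⁺ (All.map ℕ.s<s (increasing-pairs-increasing n)))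

increasing-pairs-unique : ∀ n → Unique (increasing-pairs n)
increasing-pairs-unique ℕ.zero  = Unique.[]
increasing-pairs-unique (suc n) =
  Unique.++⁺ (Unique.map⁺ (λ { refl → refl }) (Unique.allFin⁺ n))
             (Unique.map⁺ suc×suc-injective (increasing-pairs-unique n))
             first-zero-or-suc
  where
  suc×suc-injective : ∀ {x y : Fin n × Fin n} → Product.map suc suc x ≡ Product.map suc suc y → x ≡ y
  suc×suc-injective {_ , _} {_ , _} refl = refl
  first-zero-or-suc : ∀ {v} → ¬ (v ∈ map (λ j → zero , suc j) (allFin n) ×
                                 v ∈ map (Product.map suc suc) (increasing-pairs n))
  first-zero-or-suc (v∈₁ , v∈₂) with ∈-map⁻ _ v∈₁ | ∈-map⁻ _ v∈₂
  ... | _ , _ , refl | _ , _ , ()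

length-increasing-pairs : ∀ n → 2 * length (increasing-pairs n) + n ≡ n * n
length-increasing-pairs ℕ.zero  = refl
length-increasing-pairs (suc n) = begin
  2 * length (increasing-pairs (suc n)) + suc n
    ≡⟨ cong (λ l → 2 * l + suc n) length-step ⟩
  2 * (n + length (increasing-pairs n)) + suc n
    ≡⟨ regroup n (length (increasing-pairs n)) ⟩
  suc (2 * n + (2 * length (increasing-pairs n) + n))
    ≡⟨ cong (λ m → suc (2 * n + m)) (length-increasing-pairs n) ⟩
  suc (2 * n + n * n)
    ≡⟨ square-suc n ⟩
  suc n * suc n ∎
  where
  open ≡-Reasoning
  length-step : length (increasing-pairs (suc n)) ≡ n + length (increasing-pairs n)
  length-step = begin
    length (increasing-pairs (suc n))
      ≡⟨ length-++ (map (λ j → zero , suc j) (allFin n)) ⟩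
    length (map (λ j → zero , suc j) (allFin n)) + length (map (Product.map suc suc) (increasing-pairs n))
      ≡⟨ cong₂ _+_ (trans (length-map _ (allFin n)) (length-tabulate _)) (length-map _ (increasing-pairs n)) ⟩
    n + length (increasing-pairs n) ∎
  regroup : ∀ n l → 2 * (n + l) + suc n ≡ suc (2 * n + (2 * l + n))
  regroup = solve-∀
  square-suc : ∀ n → suc (2 * n + n * n) ≡ suc n * suc n
  square-suc = solve-∀

cone : ∀ {n} → Fin n × Fin n → Triple (suc n)
cone (b , c) = zero , suc b , suc c

star : (n : ℕ) → Hypergraph3 (suc n)
star n = record
  { edges    = map cone (increasing-pairs n)
  ; sorted   = All.map⁺ (All.map (λ b<c → ℕ.z<s , ℕ.s<s b<c) (increasing-pairs-increasing n))
  ; distinct = Unique.map⁺ cone-injective (increasing-pairs-unique n)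
  }
  where
  cone-injective : ∀ {x y : Fin n × Fin n} → cone x ≡ cone y → x ≡ y
  cone-injective {_ , _} {_ , _} refl = refl

star-edge-unique : ∀ {n t t′ u v} → t ∈ edges (star n) → t′ ∈ edges (star n) →
                   u ≢ v → u ≢ zero → v ≢ zero →
                   u ∈₃ t → v ∈₃ t → u ∈₃ t′ → v ∈₃ t′ → t ≡ t′
star-edge-unique {n} t∈ t′∈ u≢v u≢0 v≢0 u∈t v∈t u∈t′ v∈t′
  with (b , c) , bc∈ , refl ← ∈-map⁻ cone t∈
  with (b′ , c′) , bc∈′ , refl ← ∈-map⁻ cone t′∈
  = cong (zero ,_) (orients-unique
      (ℕ.s<s (All.lookup (increasing-pairs-increasing n) bc∈))
      (ℕ.s<s (All.lookup (increasing-pairs-increasing n) bc∈′))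
      (orients u≢v (off-centre u≢0 u∈t) (off-centre v≢0 v∈t))
      (orients u≢v (off-centre u≢0 u∈t′) (off-centre v≢0 v∈t′)))
  where
  off-centre : ∀ {x p q} → x ≢ zero → x ∈₃ (zero , p , q) → x ≡ p ⊎ x ≡ q
  off-centre x≢0 (inj₁ x≡0) = ⊥-elim (x≢0 x≡0)
  off-centre _   (inj₂ x∈)  = x∈

star-free : ∀ n → ¬ ContainsB23K3 (star n)
star-free n (x , y , z , x≢y , y≢z , x≢z , f , f-inj , f∈ ,
             (x∈₀ , y∈₀) , (x∈₁ , y∈₁) , (y∈₂ , z∈₂) , (y∈₃ , z∈₃) , (x∈₄ , z∈₄) , (x∈₅ , z∈₅))
  with x Fin.≟ zero | y Fin.≟ zero
... | yes refl | _
  with () ← f-inj (star-edge-unique (f∈ 2F) (f∈ 3F) y≢z (x≢y ∘ sym) (x≢z ∘ sym) y∈₂ z∈₂ y∈₃ z∈₃)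
... | no x≢0 | no y≢0
  with () ← f-inj (star-edge-unique (f∈ 0F) (f∈ 1F) x≢y x≢0 y≢0 x∈₀ y∈₀ x∈₁ y∈₁)
... | no x≢0 | yes refl
  with () ← f-inj (star-edge-unique (f∈ 4F) (f∈ 5F) x≢z x≢0 (y≢z ∘ sym) x∈₄ z∈₄ x∈₅ z∈₅)

n^2≡n*n : ∀ n → n ^ 2 ≡ n * n
n^2≡n*n n = cong (n *_) (ℕ.*-identityʳ n)

ex-upper : ∀ {n m} → IsEx n m → 2 * m ≤ n ^ 2
ex-upper {n} ((H , free , refl) , _) = begin
  2 * numEdges H ≡⟨ ℕ.*-comm 2 (numEdges H) ⟩
  numEdges H * 2 ≤⟨ free⇒edges≤ H free ⟩
  n * n          ≡⟨ n^2≡n*n n ⟨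
  n ^ 2          ∎
  where open ℕ.≤-Reasoning

ex-lower : ∀ {n m} → IsEx n m → n ^ 2 ≤ 2 * m + 3 * n
ex-lower {ℕ.zero} _ = ℕ.z≤n
ex-lower {suc n} {m} (_ , maximal) = begin
  suc n ^ 2               ≡⟨ n^2≡n*n (suc n) ⟩
  suc n * suc n           ≡⟨ expand n ⟩
  n * n + (2 * n + 1)     ≡⟨ cong (_+ (2 * n + 1)) (length-increasing-pairs n) ⟨
  2 * l + n + (2 * n + 1) ≡⟨ regroup n l ⟩
  2 * l + (3 * n + 1)     ≤⟨ ℕ.+-mono-≤ (ℕ.*-monoʳ-≤ 2 l≤m) (ℕ.m≤m+n (3 * n + 1) 2) ⟩
  2 * m + (3 * n + 1 + 2) ≡⟨ cong (2 * m +_) (three-suc n) ⟩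
  2 * m + 3 * suc n       ∎
  where
  open ℕ.≤-Reasoning
  l : ℕ
  l = length (increasing-pairs n)
  l≤m : l ≤ m
  l≤m = subst (_≤ m) (length-map cone (increasing-pairs n)) (maximal (star n) (star-free n))
  expand : ∀ n → (1 + n) * (1 + n) ≡ n * n + (2 * n + 1)
  expand = solve-∀
  regroup : ∀ n l → 2 * l + n + (2 * n + 1) ≡ 2 * l + (3 * n + 1)
  regroup = solve-∀
  three-suc : ∀ n → 3 * n + 1 + 2 ≡ 3 * suc n
  three-suc = solve-∀

sandwich : ∀ c {n m} → 2 * m ≤ n ^ 2 → n ^ 2 ≤ 2 * m + 3 * n → 3 * c ≤ n →
           (c * (2 * m) ≤ c * n ^ 2 + 2 * n ^ 2) × (c * n ^ 2 ≤ c * (2 * m) + 2 * n ^ 2)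
sandwich c {n} {m} upper lower 3c≤n =
  ℕ.≤-trans (ℕ.*-monoʳ-≤ c upper) (ℕ.m≤m+n _ _) ,
  (begin
    c * n ^ 2               ≤⟨ ℕ.*-monoʳ-≤ c lower ⟩
    c * (2 * m + 3 * n)     ≡⟨ distribute c m n ⟩
    c * (2 * m) + 3 * c * n ≤⟨ ℕ.+-monoʳ-≤ (c * (2 * m)) (ℕ.*-monoˡ-≤ n (ℕ.≤-trans 3c≤n (ℕ.m≤m*n n 2))) ⟩
    c * (2 * m) + n * 2 * n ≡⟨ cong (c * (2 * m) +_) (trans (cong (2 *_) (n^2≡n*n n)) (twice n)) ⟨
    c * (2 * m) + 2 * n ^ 2 ∎)
  where
  open ℕ.≤-Reasoning
  distribute : ∀ c m n → c * (2 * m + 3 * n) ≡ c * (2 * m) + 3 * c * n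
  distribute = solve-∀
  twice : ∀ n → 2 * (n * n) ≡ n * 2 * n
  twice = solve-∀

proposition9 : ∀ (k : ℕ) → Σ ℕ λ N → ∀ (n m : ℕ) → N ≤ n → IsEx n m →
    (suc k * (2 * m) ≤ suc k * n ^ 2 + 2 * n ^ 2) ×
    (suc k * n ^ 2 ≤ suc k * (2 * m) + 2 * n ^ 2)
proposition9 k = 3 * suc k , λ n m N≤n ex → sandwich (suc k) {n} {m} (ex-upper ex) (ex-lower ex) N≤n
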